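{- An edge-colored graph is a chromotopology of dimension $n$ if and only if it is isomorphic, as an edge-colored graph, to a quotient $I^n_c/L$ where $L\subseteq\mathbf{Z}_2^n$ is an even code containing no bitstring of weight $2$.
   Context: A code is a $\mathbf{Z}_2$-subspace $L\subseteq\mathbf{Z}_2^n$; the weight of a bitstring is its number of $1$'s, and $L$ is even if all its elements have even weight. With $e_i$ the $i$-th standard basis vector, $I^n_c/L$ is the edge-colored multigraph with vertex set $\mathbf{Z}_2^n/L$ having, for each coset $C$ and each color $i\in[n]$, an edge of color $i$ joining $C$ and $C+e_i$ (one per unordered pair and color; a loop if $e_i\in L$). A chromotopology of dimension $n$ is a finite connected simple bipartite graph in which every vertex has degree $n$, whose edges are colored by $[n]$ so that each vertex is incident to exactly one edge of each color, and such that for any distinct colors $i,j$ the edges of colors $i$ and $j$ form a disjoint union of $4$-cycles. -}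

module Defs where

open import Data.Nat using (ℕ; zero; suc; _+_)
open import Data.Nat.Divisibility using (_∣_)
open import Data.Bool using (Bool; true; false; _xor_)
open import Data.Fin using (Fin)
open import Data.Vec using (Vec; []; _∷_; zipWith; replicate)
open import Data.Product using (Σ; _×_; _,_)
open import Data.Sum using (_⊎_)
open import Relation.Binary.PropositionalEquality using (_≡_; _≢_)
open import Function.Bundles using (_↔_; _⇔_)
import Data.Fin as F

Word : ℕ → Set
Word n = Vec Bool n

_⊕_ : ∀ {n} → Word n → Word n → Word n
_⊕_ = zipWith _xor_

𝟘 : ∀ {n} → Word n
𝟘 = replicate _ false

e : ∀ {n} → Fin n → Word n
e {suc n} F.zero    = true ∷ 𝟘
e {suc n} (F.suc i) = false ∷ e i

weight : ∀ {n} → Word n → ℕ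
weight [] = 0
weight (true  ∷ w) = suc (weight w)
weight (false ∷ w) = weight w

-- Codes: Z₂-subspaces of Z₂ⁿ, given by their (Boolean) membership
-- function.  Over Z₂ a subspace is a subset containing 0 and closed
-- under addition.

record Code (n : ℕ) : Set where
  field
    mem     : Word n → Bool
    mem-𝟘   : mem 𝟘 ≡ true
    mem-⊕   : ∀ x y → mem x ≡ true → mem y ≡ true → mem (x ⊕ y) ≡ true
open Code public

Even : ∀ {n} → Code n → Set
Even L = ∀ w → mem L w ≡ true → 2 ∣ weight w

NoWeight2 : ∀ {n} → Code n → Set
NoWeight2 L = ∀ w → mem L w ≡ true → weight w ≢ 2

-- Edge-colored multigraphs with colors in [n] = Fin n.
-- Each edge e has two endpoints src e, tgt e (the order is irrelevant;
-- a loop has src e ≡ tgt e) and a color.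

record ECGraph (n : ℕ) : Set₁ where
  field
    V   : Set
    E   : Set
    src : E → V
    tgt : E → V
    col : E → Fin n
open ECGraph public

module _ {n : ℕ} (G : ECGraph n) where

  Incident : E G → V G → Set
  Incident ed v = src G ed ≡ v ⊎ tgt G ed ≡ v

  Joins : E G → V G → V G → Set
  Joins ed u w = (src G ed ≡ u × tgt G ed ≡ w) ⊎ (src G ed ≡ w × tgt G ed ≡ u)

  data Walk : V G → V G → Set where
    here : ∀ {v} → Walk v v
    step : ∀ {u w v} (ed : E G) → Joins ed u w → Walk w v → Walk u v

  Finite : Set → Set
  Finite A = Σ ℕ (λ k → A ↔ Fin k)

  -- the subgraph H formed by the edges satisfying P is a disjoint union of
  -- 4-cycles: every vertex of H (i.e. incident to an edge of H) has degree
  -- exactly 2 in H and lies on a 4-cycle of H (4 distinct vertices).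
  -- (A graph all of whose vertices have degree 2 is a disjoint union of
  -- cycles, and a vertex on a 4-cycle then has that cycle as its component.)
  UnionOf4Cycles : (E G → Set) → Set
  UnionOf4Cycles P =
    ∀ v → Σ (E G) (λ ed → P ed × Incident ed v) →
      (Σ (E G) (λ ed → P ed × Incident ed v) ↔ Fin 2)
      × Σ (V G) λ v₁ → Σ (V G) λ v₂ → Σ (V G) λ v₃ →
        Σ (E G) λ e₁ → Σ (E G) λ e₂ → Σ (E G) λ e₃ → Σ (E G) λ e₄ →
          (P e₁ × P e₂ × P e₃ × P e₄)
        × (Joins e₁ v v₁ × Joins e₂ v₁ v₂ × Joins e₃ v₂ v₃ × Joins e₄ v₃ v)
        × (v ≢ v₁ × v ≢ v₂ × v ≢ v₃ × v₁ ≢ v₂ × v₁ ≢ v₃ × v₂ ≢ v₃)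

  record Chromotopology : Set where
    field
      finiteV   : Finite (V G)
      finiteE   : Finite (E G)
      nonempty  : V G
      connected : ∀ u v → Walk u v
      noLoops   : ∀ ed → src G ed ≢ tgt G ed
      noMulti   : ∀ ed ed' → Joins ed' (src G ed) (tgt G ed) → ed ≡ ed'
      bipartite : Σ (V G → Bool) λ side → ∀ ed → side (src G ed) ≢ side (tgt G ed)
      regular   : ∀ v → Σ (E G) (λ ed → Incident ed v) ↔ Fin n
      colorExists : ∀ v i → Σ (E G) (λ ed → col G ed ≡ i × Incident ed v)
      colorUnique : ∀ v i ed ed' → col G ed ≡ i → Incident ed v →
                      col G ed' ≡ i → Incident ed' v → ed ≡ ed'
      squares   : ∀ i j → i ≢ j →
                    UnionOf4Cycles (λ ed → col G ed ≡ i ⊎ col G ed ≡ j)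

  -- Since Agda has no quotient types, the vertex set Z₂ⁿ/L and the edge
  -- set of I^n_c/L (pairs (coset C, color i) with (C,i) = (C+e_i,i)) are
  -- presented by their quotient maps: an isomorphism G ≅ I^n_c/L is the
  -- same as a surjection π : Z₂ⁿ → V(G) whose fibres are exactly the
  -- cosets of L, and a surjection σ : Z₂ⁿ × [n] → E(G) whose fibres are
  -- exactly the edge classes of I^n_c/L, compatible with colors and
  -- endpoints (edge (x+L, i) has color i and joins x+L and x+e_i+L).
  record IsoToQuotient (L : Code n) : Set where
    field
      π      : Word n → V G
      σ      : Word n → Fin n → E G
      π-surj : ∀ v → Σ (Word n) λ x → π x ≡ v
      π-ker  : ∀ x y → (π x ≡ π y) ⇔ (mem L (x ⊕ y) ≡ true)
      σ-surj : ∀ ed → Σ (Word n) λ x → Σ (Fin n) λ i → σ x i ≡ ed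
      σ-ker  : ∀ x y i j → (σ x i ≡ σ y j) ⇔
                 (i ≡ j × (mem L (x ⊕ y) ≡ true ⊎ mem L ((x ⊕ y) ⊕ e i) ≡ true))
      σ-col  : ∀ x i → col G (σ x i) ≡ i
      σ-ends : ∀ x i → Joins (σ x i) (π x) (π (x ⊕ e i))

-- Given a chromotopology, let tᵢ send a vertex to its neighbour along the edge of colour i.
-- The tᵢ are involutions, and the 4-cycle condition says that for i ≠ j they commute and
-- tᵢ tⱼ has no fixed point.  Hence Z₂ⁿ acts on the vertices, transitively by connectedness,
-- so the vertices are the cosets of the stabiliser L of a base vertex and the i-edges are the
-- pairs {x + L, x + eᵢ + L}.  Bipartiteness makes L even, and the fixed-point-freeness of
-- tᵢ tⱼ says that L contains no eᵢ + eⱼ.  Conversely, in I^n_c/L the parity of a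
-- representative is a proper 2-colouring when L is even, which also excludes loops, and
-- when L has no word of weight 2 the cosets of x, x + eᵢ, x + eᵢ + eⱼ, x + eⱼ are distinct,
-- so they form a 4-cycle and no two edges have the same ends.

module Submission where

open import Defs

open import Algebra.Bundles using (CommutativeRing)
open import Axiom.UniquenessOfIdentityProofs using (module Decidable⇒UIP)
open import Data.Bool using (Bool; true; false; not; _xor_; T)
open import Data.Bool.Properties
  using ( xor-assoc; xor-comm; xor-same; xor-identityˡ; xor-identityʳ; xor-∧-commutativeRing
        ; not-injective; not-¬; ¬-not; not-distribˡ-xor; T-irrelevant; T-≡ )
open import Algebra.Properties.CommutativeSemigroup
  (CommutativeRing.+-commutativeSemigroup xor-∧-commutativeRing) using (interchange)
open import Data.Empty using (⊥-elim)
open import Data.Fin using (Fin; zero; suc)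
open import Data.Fin.Properties using (suc-injective; _≟_; 2↔Bool; *↔×; inj⇒≟)
open import Data.List using (List; []; _∷_; map; foldr)
open import Data.Nat using (ℕ; zero; suc; _+_; _^_; pred)
open import Data.Nat.Divisibility using (_∣_; ∣m+n∣m⇒∣n; ∣1⇒≡1; n∣n; ∣m∣n⇒∣m+n; _∣0)
open import Data.Nat.Properties using (+-comm)
open import Data.Product using (Σ; ∃-syntax; _×_; _,_; proj₁; proj₂; uncurry)
open import Data.Product.Function.NonDependent.Propositional using (_×-↔_)
open import Data.Sum as Sum using (_⊎_; inj₁; inj₂)
open import Data.Unit using (tt)
open import Data.Vec using ([]; _∷_)
open import Data.Vec.Properties using (zipWith-assoc; zipWith-comm; zipWith-identityˡ; zipWith-identityʳ)
open import Function using (_∘_; id)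
open import Function.Bundles using (_↔_; mk↔ₛ′; Inverse; _⇔_; mk⇔; Equivalence)
open import Function.Properties.Inverse using (↔-refl; ↔-trans; ↔-sym; ↔⇒↣)
open import Relation.Binary.Definitions using (DecidableEquality)
open import Relation.Binary.PropositionalEquality
open import Relation.Nullary using (¬_; yes; no)
open import Relation.Nullary.Decidable using (isYes; toWitness; fromWitness)

⊕-assoc : ∀ {n} (x y z : Word n) → (x ⊕ y) ⊕ z ≡ x ⊕ (y ⊕ z)
⊕-assoc = zipWith-assoc xor-assoc

⊕-comm : ∀ {n} (x y : Word n) → x ⊕ y ≡ y ⊕ x
⊕-comm = zipWith-comm xor-comm

⊕-identityˡ : ∀ {n} (x : Word n) → 𝟘 ⊕ x ≡ x
⊕-identityˡ = zipWith-identityˡ xor-identityˡ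

⊕-identityʳ : ∀ {n} (x : Word n) → x ⊕ 𝟘 ≡ x
⊕-identityʳ = zipWith-identityʳ xor-identityʳ

⊕-self : ∀ {n} (x : Word n) → x ⊕ x ≡ 𝟘
⊕-self []      = refl
⊕-self (b ∷ x) = cong₂ _∷_ (xor-same b) (⊕-self x)

⊕-interchange : ∀ {n} (a b c d : Word n) → (a ⊕ b) ⊕ (c ⊕ d) ≡ (a ⊕ c) ⊕ (b ⊕ d)
⊕-interchange []      []      []      []      = refl
⊕-interchange (a ∷ x) (b ∷ y) (c ∷ z) (d ∷ w) = cong₂ _∷_ (interchange a b c d) (⊕-interchange x y z w)

x⊕xy≡y : ∀ {n} (x y : Word n) → x ⊕ (x ⊕ y) ≡ y
x⊕xy≡y x y = begin
  x ⊕ (x ⊕ y)  ≡⟨ ⊕-assoc x x y ⟨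
  (x ⊕ x) ⊕ y  ≡⟨ cong (_⊕ y) (⊕-self x) ⟩
  𝟘 ⊕ y        ≡⟨ ⊕-identityˡ y ⟩
  y            ∎
  where open ≡-Reasoning

xy⊕y≡x : ∀ {n} (x y : Word n) → (x ⊕ y) ⊕ y ≡ x
xy⊕y≡x x y = begin
  (x ⊕ y) ⊕ y  ≡⟨ ⊕-assoc x y y ⟩
  x ⊕ (y ⊕ y)  ≡⟨ cong (x ⊕_) (⊕-self y) ⟩
  x ⊕ 𝟘        ≡⟨ ⊕-identityʳ x ⟩
  x            ∎
  where open ≡-Reasoning

xy⊕z≡xz⊕y : ∀ {n} (x y z : Word n) → (x ⊕ y) ⊕ z ≡ (x ⊕ z) ⊕ y
xy⊕z≡xz⊕y x y z = begin
  (x ⊕ y) ⊕ z  ≡⟨ ⊕-assoc x y z ⟩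
  x ⊕ (y ⊕ z)  ≡⟨ cong (x ⊕_) (⊕-comm y z) ⟩
  x ⊕ (z ⊕ y)  ≡⟨ ⊕-assoc x z y ⟨
  (x ⊕ z) ⊕ y  ∎
  where open ≡-Reasoning

xz⊕yz≡xy : ∀ {n} (x y z : Word n) → (x ⊕ z) ⊕ (y ⊕ z) ≡ x ⊕ y
xz⊕yz≡xy x y z = begin
  (x ⊕ z) ⊕ (y ⊕ z)  ≡⟨ ⊕-interchange x z y z ⟩
  (x ⊕ y) ⊕ (z ⊕ z)  ≡⟨ cong ((x ⊕ y) ⊕_) (⊕-self z) ⟩
  (x ⊕ y) ⊕ 𝟘        ≡⟨ ⊕-identityʳ (x ⊕ y) ⟩
  x ⊕ y              ∎
  where open ≡-Reasoning

xy⊕xz≡yz : ∀ {n} (x y z : Word n) → (x ⊕ y) ⊕ (x ⊕ z) ≡ y ⊕ z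
xy⊕xz≡yz x y z = begin
  (x ⊕ y) ⊕ (x ⊕ z)  ≡⟨ ⊕-interchange x y x z ⟩
  (x ⊕ x) ⊕ (y ⊕ z)  ≡⟨ cong (_⊕ (y ⊕ z)) (⊕-self x) ⟩
  𝟘 ⊕ (y ⊕ z)        ≡⟨ ⊕-identityˡ (y ⊕ z) ⟩
  y ⊕ z              ∎
  where open ≡-Reasoning

basisSum : ∀ {n} → List (Fin n) → Word n
basisSum = foldr (λ i w → e i ⊕ w) 𝟘

support : ∀ {n} → Word n → List (Fin n)
support []          = []
support (false ∷ w) = map suc (support w)
support (true ∷ w)  = zero ∷ map suc (support w)

basisSum-map-suc : ∀ {n} (is : List (Fin n)) → basisSum (map suc is) ≡ false ∷ basisSum is
basisSum-map-suc []       = refl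
basisSum-map-suc (i ∷ is) = cong ((false ∷ e i) ⊕_) (basisSum-map-suc is)

basisSum-support : ∀ {n} (w : Word n) → basisSum (support w) ≡ w
basisSum-support []          = refl
basisSum-support (false ∷ w) = trans (basisSum-map-suc (support w)) (cong (false ∷_) (basisSum-support w))
basisSum-support (true ∷ w)  = begin
  (true ∷ 𝟘) ⊕ basisSum (map suc (support w))  ≡⟨ cong ((true ∷ 𝟘) ⊕_) (basisSum-map-suc (support w)) ⟩
  true ∷ (𝟘 ⊕ basisSum (support w))            ≡⟨ cong (true ∷_) (⊕-identityˡ _) ⟩
  true ∷ basisSum (support w)                  ≡⟨ cong (true ∷_) (basisSum-support w) ⟩
  true ∷ w                                     ∎
  where open ≡-Reasoning

weight-𝟘 : ∀ {n} → weight (𝟘 {n}) ≡ 0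
weight-𝟘 {zero}  = refl
weight-𝟘 {suc n} = weight-𝟘 {n}

weight-e : ∀ {n} (i : Fin n) → weight (e i) ≡ 1
weight-e {suc n} zero    = cong suc (weight-𝟘 {n})
weight-e         (suc i) = weight-e i

weight-e⊕e : ∀ {n} {i j : Fin n} → i ≢ j → weight (e i ⊕ e j) ≡ 2
weight-e⊕e {i = zero}  {zero}  i≢j = ⊥-elim (i≢j refl)
weight-e⊕e {i = zero}  {suc j} _   = cong suc (trans (cong weight (⊕-identityˡ (e j))) (weight-e j))
weight-e⊕e {i = suc i} {zero}  _   = cong suc (trans (cong weight (⊕-identityʳ (e i))) (weight-e i))
weight-e⊕e {i = suc i} {suc j} i≢j = weight-e⊕e (λ i≡j → i≢j (cong suc i≡j))

weight≡0⇒𝟘 : ∀ {n} (w : Word n) → weight w ≡ 0 → w ≡ 𝟘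
weight≡0⇒𝟘 []          _  = refl
weight≡0⇒𝟘 (false ∷ w) eq = cong (false ∷_) (weight≡0⇒𝟘 w eq)

weight≡1⇒e : ∀ {n} (w : Word n) → weight w ≡ 1 → ∃[ i ] w ≡ e i
weight≡1⇒e (true ∷ w)  eq = zero , cong (true ∷_) (weight≡0⇒𝟘 w (cong pred eq))
weight≡1⇒e (false ∷ w) eq with weight≡1⇒e w eq
... | i , w≡eᵢ = suc i , cong (false ∷_) w≡eᵢ

weight≡2⇒e⊕e : ∀ {n} (w : Word n) → weight w ≡ 2 → ∃[ i ] ∃[ j ] i ≢ j × w ≡ e i ⊕ e j
weight≡2⇒e⊕e (true ∷ w) eq with weight≡1⇒e w (cong pred eq)
... | j , w≡eⱼ = zero , suc j , (λ ()) , cong (true ∷_) (trans w≡eⱼ (sym (⊕-identityˡ (e j))))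
weight≡2⇒e⊕e (false ∷ w) eq with weight≡2⇒e⊕e w eq
... | i , j , i≢j , w≡eᵢ⊕eⱼ = suc i , suc j , (λ p → i≢j (suc-injective p)) , cong (false ∷_) w≡eᵢ⊕eⱼ

¬2∣1 : ¬ 2 ∣ 1
¬2∣1 2∣1 with ∣1⇒≡1 2∣1
... | ()

parity : ∀ {n} → Word n → Bool
parity []      = false
parity (b ∷ w) = b xor parity w

parity-⊕ : ∀ {n} (x y : Word n) → parity (x ⊕ y) ≡ parity x xor parity y
parity-⊕ []      []      = refl
parity-⊕ (a ∷ x) (b ∷ y) = trans (cong ((a xor b) xor_) (parity-⊕ x y)) (interchange a b (parity x) (parity y))

parity-𝟘 : ∀ {n} → parity (𝟘 {n}) ≡ false
parity-𝟘 {zero}  = refl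
parity-𝟘 {suc n} = parity-𝟘 {n}

parity-e : ∀ {n} (i : Fin n) → parity (e i) ≡ true
parity-e {suc n} zero    = cong (true xor_) (parity-𝟘 {n})
parity-e         (suc i) = parity-e i

mutual
  parity≡false⇒2∣weight : ∀ {n} (w : Word n) → parity w ≡ false → 2 ∣ weight w
  parity≡false⇒2∣weight []          _  = 2 ∣0
  parity≡false⇒2∣weight (false ∷ w) eq = parity≡false⇒2∣weight w eq
  parity≡false⇒2∣weight (true ∷ w)  eq = parity≡true⇒2∣1+weight w (not-injective eq)

  parity≡true⇒2∣1+weight : ∀ {n} (w : Word n) → parity w ≡ true → 2 ∣ suc (weight w)
  parity≡true⇒2∣1+weight (false ∷ w) eq = parity≡true⇒2∣1+weight w eq
  parity≡true⇒2∣1+weight (true ∷ w)  eq = ∣m∣n⇒∣m+n n∣n (parity≡false⇒2∣weight w (not-injective eq))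

2∣weight⇒parity≡false : ∀ {n} (w : Word n) → 2 ∣ weight w → parity w ≡ false
2∣weight⇒parity≡false w 2∣w with parity w in eq
... | false = refl
... | true  = ⊥-elim (¬2∣1 (∣m+n∣m⇒∣n 2∣w+1 2∣w))
  where
  2∣w+1 : 2 ∣ weight w + 1
  2∣w+1 = subst (2 ∣_) (+-comm 1 (weight w)) (parity≡true⇒2∣1+weight w eq)

∈-resp : ∀ {n} (L : Code n) {x y : Word n} → x ≡ y → mem L x ≡ true → mem L y ≡ true
∈-resp L = subst (λ w → mem L w ≡ true)

parity-coset : ∀ {n} (L : Code n) → Even L → ∀ {x y} → mem L (x ⊕ y) ≡ true → parity x ≡ parity y
parity-coset L even {x} {y} x⊕y∈L = begin
  parity x                       ≡⟨ cong parity (xy⊕y≡x x y) ⟨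
  parity ((x ⊕ y) ⊕ y)           ≡⟨ parity-⊕ (x ⊕ y) y ⟩
  parity (x ⊕ y) xor parity y    ≡⟨ cong (_xor parity y) (2∣weight⇒parity≡false (x ⊕ y) (even _ x⊕y∈L)) ⟩
  parity y                       ∎
  where open ≡-Reasoning

Σ-≡-irrelevant : ∀ {A : Set} {B : A → Set} → (∀ a (b b′ : B a) → b ≡ b′) →
                 ∀ {a a′} {b : B a} {b′ : B a′} → a ≡ a′ → _≡_ {A = Σ A B} (a , b) (a′ , b′)
Σ-≡-irrelevant irr {a} refl = cong (a ,_) (irr a _ _)

Σ-T-≡ : ∀ {A : Set} {p : A → Bool} {a b : A} {t : T (p a)} {u : T (p b)} →
        a ≡ b → _≡_ {A = Σ A (T ∘ p)} (a , t) (b , u)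
Σ-T-≡ = Σ-≡-irrelevant (λ _ → T-irrelevant)

count : ∀ {m} → (Fin m → Bool) → ℕ
count {zero}  p = 0
count {suc m} p with p zero
... | true  = suc (count (p ∘ suc))
... | false = count (p ∘ suc)

Σ-T↔Fin-count : ∀ {m} (p : Fin m → Bool) → Σ (Fin m) (T ∘ p) ↔ Fin (count p)
Σ-T↔Fin-count {zero}  p = mk↔ₛ′ (λ ()) (λ ()) (λ ()) (λ ())
Σ-T↔Fin-count {suc m} p with p zero in p₀ | Σ-T↔Fin-count (p ∘ suc)
... | true | ih = mk↔ₛ′ to from to∘from from∘to
  where
  open Inverse ih using () renaming (to to toᵢₕ; from to fromᵢₕ; strictlyInverseˡ to invˡ; strictlyInverseʳ to invʳ)
  to : Σ (Fin (suc m)) (T ∘ p) → Fin (suc (count (p ∘ suc)))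
  to (zero  , _) = zero
  to (suc i , t) = suc (toᵢₕ (i , t))
  from : Fin (suc (count (p ∘ suc))) → Σ (Fin (suc m)) (T ∘ p)
  from zero    = zero , subst T (sym p₀) tt
  from (suc k) = suc (proj₁ (fromᵢₕ k)) , proj₂ (fromᵢₕ k)
  to∘from : ∀ k → to (from k) ≡ k
  to∘from zero    = refl
  to∘from (suc k) = cong suc (invˡ k)
  from∘to : ∀ x → from (to x) ≡ x
  from∘to (zero  , _) = Σ-T-≡ refl
  from∘to (suc i , t) = Σ-T-≡ (cong (suc ∘ proj₁) (invʳ (i , t)))
... | false | ih = mk↔ₛ′ to from invˡ from∘to
  where
  open Inverse ih using () renaming (to to toᵢₕ; from to fromᵢₕ; strictlyInverseˡ to invˡ; strictlyInverseʳ to invʳ)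
  to : Σ (Fin (suc m)) (T ∘ p) → Fin (count (p ∘ suc))
  to (zero  , t) = ⊥-elim (subst T p₀ t)
  to (suc i , t) = toᵢₕ (i , t)
  from : Fin (count (p ∘ suc)) → Σ (Fin (suc m)) (T ∘ p)
  from k = suc (proj₁ (fromᵢₕ k)) , proj₂ (fromᵢₕ k)
  from∘to : ∀ x → from (to x) ≡ x
  from∘to (zero  , t) = ⊥-elim (subst T p₀ t)
  from∘to (suc i , t) = Σ-T-≡ (cong (suc ∘ proj₁) (invʳ (i , t)))

-- A retract of Fin m is isomorphic to the set of fixed points of the induced idempotent on Fin m.
retract-finite : ∀ {m} {A B : Set} → B ↔ Fin m → (f : B → A) (s : A → B) →
                 (∀ a → f (s a) ≡ a) → ∃[ k ] (A ↔ Fin k)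
retract-finite {m} {A} B↔Fin f s f∘s = count fixed , ↔-trans A↔fixed (Σ-T↔Fin-count fixed)
  where
  open Inverse B↔Fin
  idem : Fin m → Fin m
  idem i = to (s (f (from i)))
  fixed : Fin m → Bool
  fixed i = isYes (idem i ≟ i)
  idem-to∘s : ∀ a → idem (to (s a)) ≡ to (s a)
  idem-to∘s a = cong (to ∘ s) (trans (cong f (strictlyInverseʳ (s a))) (f∘s a))
  A↔fixed : A ↔ Σ (Fin m) (T ∘ fixed)
  A↔fixed = mk↔ₛ′ (λ a → to (s a) , fromWitness (idem-to∘s a)) (λ (i , _) → f (from i))
    (λ (i , t) → Σ-T-≡ (toWitness t))
    (λ a → trans (cong f (strictlyInverseʳ (s a))) (f∘s a))

Word↔Fin : ∀ n → Word n ↔ Fin (2 ^ n)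
Word↔Fin zero    = mk↔ₛ′ (λ _ → zero) (λ _ → []) (λ { zero → refl }) (λ { [] → refl })
Word↔Fin (suc n) = ↔-trans Word↔Bool×Word (↔-trans (↔-sym 2↔Bool ×-↔ Word↔Fin n) (↔-sym *↔×))
  where
  Word↔Bool×Word : Word (suc n) ↔ (Bool × Word n)
  Word↔Bool×Word = mk↔ₛ′ (λ { (b ∷ w) → b , w }) (λ (b , w) → b ∷ w) (λ _ → refl) (λ { (b ∷ w) → refl })

SamePair : {A : Set} → A → A → A → A → Set
SamePair a b c d = (a ≡ c × b ≡ d) ⊎ (a ≡ d × b ≡ c)

module _ {A : Set} {a b c d : A} where

  samePair-sym : SamePair a b c d → SamePair c d a b
  samePair-sym (inj₁ (a≡c , b≡d)) = inj₁ (sym a≡c , sym b≡d)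
  samePair-sym (inj₂ (a≡d , b≡c)) = inj₂ (sym b≡c , sym a≡d)

  samePair-trans : ∀ {x y} → SamePair a b c d → SamePair c d x y → SamePair a b x y
  samePair-trans (inj₁ (p , q)) (inj₁ (r , s)) = inj₁ (trans p r , trans q s)
  samePair-trans (inj₁ (p , q)) (inj₂ (r , s)) = inj₂ (trans p r , trans q s)
  samePair-trans (inj₂ (p , q)) (inj₁ (r , s)) = inj₂ (trans p s , trans q r)
  samePair-trans (inj₂ (p , q)) (inj₂ (r , s)) = inj₁ (trans p s , trans q r)

  samePair-apart : ∀ {X : Set} (h : A → X) → SamePair a b c d → h a ≢ h b → h c ≢ h d
  samePair-apart h (inj₁ (refl , refl)) ha≢hb = ha≢hb
  samePair-apart h (inj₂ (refl , refl)) ha≢hb = ha≢hb ∘ sym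

-- Joins G ed u w unfolds to SamePair (src G ed) (tgt G ed) u w.
module _ {n} (G : ECGraph n) {ed : E G} where

  joins-sym : ∀ {u w} → Joins G ed u w → Joins G ed w u
  joins-sym (inj₁ p) = inj₂ p
  joins-sym (inj₂ p) = inj₁ p

  joins⇒incident : ∀ {u w} → Joins G ed u w → Incident G ed u
  joins⇒incident (inj₁ (src≡u , _)) = inj₁ src≡u
  joins⇒incident (inj₂ (_ , tgt≡u)) = inj₂ tgt≡u

  incident⇒endpoint : ∀ {u w v} → Joins G ed u w → Incident G ed v → v ≡ u ⊎ v ≡ w
  incident⇒endpoint (inj₁ (p , _)) (inj₁ r) = inj₁ (trans (sym r) p)
  incident⇒endpoint (inj₁ (_ , q)) (inj₂ r) = inj₂ (trans (sym r) q)
  incident⇒endpoint (inj₂ (p , _)) (inj₁ r) = inj₂ (trans (sym r) p)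
  incident⇒endpoint (inj₂ (_ , q)) (inj₂ r) = inj₁ (trans (sym r) q)

  incident-irrelevant : src G ed ≢ tgt G ed → ∀ {v} (p q : Incident G ed v) → p ≡ q
  incident-irrelevant _      (inj₁ refl) (inj₁ refl) = refl
  incident-irrelevant noLoop (inj₁ p)    (inj₂ q)    = ⊥-elim (noLoop (trans p (sym q)))
  incident-irrelevant noLoop (inj₂ p)    (inj₁ q)    = ⊥-elim (noLoop (trans q (sym p)))
  incident-irrelevant _      (inj₂ refl) (inj₂ refl) = refl

-- Quotients of the cube are chromotopologies

module QuotientIsChromotopology {n} {G : ECGraph n} {L : Code n}
  (even : Even L) (noWeight2 : NoWeight2 L) (Q : IsoToQuotient G L) where

  open IsoToQuotient Q

  e∉L : ∀ i → mem L (e i) ≢ true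
  e∉L i eᵢ∈L = ¬2∣1 (subst (2 ∣_) (weight-e i) (even (e i) eᵢ∈L))

  e⊕e∉L : ∀ {i j} → i ≢ j → mem L (e i ⊕ e j) ≢ true
  e⊕e∉L i≢j eᵢ⊕eⱼ∈L = noWeight2 _ eᵢ⊕eⱼ∈L (weight-e⊕e i≢j)

  π-≡⇒∈ : ∀ {x y} → π x ≡ π y → mem L (x ⊕ y) ≡ true
  π-≡⇒∈ = Equivalence.to (π-ker _ _)

  ∈⇒π-≡ : ∀ {x y} → mem L (x ⊕ y) ≡ true → π x ≡ π y
  ∈⇒π-≡ = Equivalence.from (π-ker _ _)

  π-translate : ∀ {x y} a → π x ≡ π y → π (x ⊕ a) ≡ π (y ⊕ a)
  π-translate {x} {y} a πx≡πy = ∈⇒π-≡ (∈-resp L (sym (xz⊕yz≡xy x y a)) (π-≡⇒∈ πx≡πy))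

  π-apart : ∀ {x a} → mem L a ≢ true → π x ≢ π (x ⊕ a)
  π-apart {x} {a} a∉L eq = a∉L (∈-resp L (x⊕xy≡y x a) (π-≡⇒∈ eq))

  π-apart₂ : ∀ {x a b} → mem L (a ⊕ b) ≢ true → π (x ⊕ a) ≢ π (x ⊕ b)
  π-apart₂ {x} {a} {b} a⊕b∉L eq = a⊕b∉L (∈-resp L (xy⊕xz≡yz x a b) (π-≡⇒∈ eq))

  rep : V G → Word n
  rep v = proj₁ (π-surj v)

  π-rep : ∀ v → π (rep v) ≡ v
  π-rep v = proj₂ (π-surj v)

  finite-V : Finite G (V G)
  finite-V = retract-finite (Word↔Fin n) π rep π-rep

  finite-E : Finite G (E G)
  finite-E = retract-finite (↔-trans (Word↔Fin n ×-↔ ↔-refl) (↔-sym *↔×)) (uncurry σ) edgeRep σ-edgeRep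
    where
    edgeRep : E G → Word n × Fin n
    edgeRep ed = let (x , i , _) = σ-surj ed in x , i
    σ-edgeRep : ∀ ed → uncurry σ (edgeRep ed) ≡ ed
    σ-edgeRep ed = proj₂ (proj₂ (σ-surj ed))

  walk-along : ∀ x is → Walk G (π x) (π (x ⊕ basisSum is))
  walk-along x []       = subst (Walk G (π x) ∘ π) (sym (⊕-identityʳ x)) here
  walk-along x (i ∷ is) = step (σ x i) (σ-ends x i)
    (subst (Walk G (π (x ⊕ e i)) ∘ π) (⊕-assoc x (e i) (basisSum is)) (walk-along (x ⊕ e i) is))

  connected : ∀ u v → Walk G u v
  connected u v = subst₂ (Walk G) (π-rep u) (trans (cong π x⊕d≡y) (π-rep v)) (walk-along x (support d))
    where
    x = rep u
    d = rep u ⊕ rep v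
    x⊕d≡y : x ⊕ basisSum (support d) ≡ rep v
    x⊕d≡y = trans (cong (x ⊕_) (basisSum-support d)) (x⊕xy≡y x (rep v))

  no-loops : ∀ ed → src G ed ≢ tgt G ed
  no-loops ed with σ-surj ed
  ... | x , i , refl = samePair-apart id (samePair-sym (σ-ends x i)) (π-apart (e∉L i))

  side : V G → Bool
  side v = parity (rep v)

  side-π : ∀ x → side (π x) ≡ parity x
  side-π x = parity-coset L even (π-≡⇒∈ (π-rep (π x)))

  bipartite : ∀ ed → side (src G ed) ≢ side (tgt G ed)
  bipartite ed with σ-surj ed
  ... | x , i , refl = samePair-apart side (samePair-sym (σ-ends x i)) sides-differ
    where
    parity-flips : parity (x ⊕ e i) ≡ not (parity x)
    parity-flips = trans (parity-⊕ x (e i)) (trans (cong (parity x xor_) (parity-e i)) (xor-comm (parity x) true))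
    sides-differ : side (π x) ≢ side (π (x ⊕ e i))
    sides-differ rewrite side-π x | side-π (x ⊕ e i) | parity-flips = not-¬ refl

  σ-cong : ∀ {x y i} → π x ≡ π y ⊎ π x ≡ π (y ⊕ e i) → σ x i ≡ σ y i
  σ-cong {x} {y} {i} (inj₁ πx≡πy) = Equivalence.from (σ-ker x y i i) (refl , inj₁ (π-≡⇒∈ πx≡πy))
  σ-cong {x} {y} {i} (inj₂ πx≡πy⊕eᵢ) =
    Equivalence.from (σ-ker x y i i) (refl , inj₂ (∈-resp L (sym (⊕-assoc x y (e i))) (π-≡⇒∈ πx≡πy⊕eᵢ)))

  σ-incident : ∀ v i → Incident G (σ (rep v) i) v
  σ-incident v i = subst (Incident G (σ (rep v) i)) (π-rep v) (joins⇒incident G (σ-ends (rep v) i))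

  incident⇒σ : ∀ {v ed} → Incident G ed v → ed ≡ σ (rep v) (col G ed)
  incident⇒σ {v} {ed} inc with σ-surj ed
  ... | y , j , refl = begin
    σ y j                     ≡⟨ σ-cong (Sum.map (trans (π-rep v)) (trans (π-rep v)) v-endpoint) ⟨
    σ (rep v) j               ≡⟨ cong (σ (rep v)) (σ-col y j) ⟨
    σ (rep v) (col G (σ y j)) ∎
    where
    open ≡-Reasoning
    v-endpoint : v ≡ π y ⊎ v ≡ π (y ⊕ e j)
    v-endpoint = incident⇒endpoint G (σ-ends y j) inc

  regular : ∀ v → Σ (E G) (λ ed → Incident G ed v) ↔ Fin n
  regular v = mk↔ₛ′ (col G ∘ proj₁) (λ i → σ (rep v) i , σ-incident v i) (σ-col (rep v))
    (λ (ed , inc) → Σ-≡-irrelevant (λ ed → incident-irrelevant G (no-loops ed)) (sym (incident⇒σ inc)))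

  colour-unique : ∀ v i ed ed′ → col G ed ≡ i → Incident G ed v → col G ed′ ≡ i → Incident G ed′ v → ed ≡ ed′
  colour-unique v i ed ed′ cᵢ inc cᵢ′ inc′ = begin
    ed                       ≡⟨ incident⇒σ inc ⟩
    σ (rep v) (col G ed)     ≡⟨ cong (σ (rep v)) (trans cᵢ (sym cᵢ′)) ⟩
    σ (rep v) (col G ed′)    ≡⟨ incident⇒σ inc′ ⟨
    ed′                      ∎
    where open ≡-Reasoning

  edge-determined : ∀ {x y i j} → SamePair (π x) (π (x ⊕ e i)) (π y) (π (y ⊕ e j)) → σ x i ≡ σ y j
  edge-determined {x} {y} {i} {j} same with i ≟ j | same
  ... | yes refl | inj₁ (πx≡πy , _)   = σ-cong (inj₁ πx≡πy)
  ... | yes refl | inj₂ (πx≡πy⊕eᵢ , _) = σ-cong (inj₂ πx≡πy⊕eᵢ)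
  ... | no i≢j   | inj₁ (πx≡πy , πx⊕eᵢ≡πy⊕eⱼ) =
    ⊥-elim (π-apart₂ (e⊕e∉L i≢j) (trans πx⊕eᵢ≡πy⊕eⱼ (sym (π-translate (e j) πx≡πy))))
  ... | no i≢j   | inj₂ (πx≡πy⊕eⱼ , πx⊕eᵢ≡πy) =
    ⊥-elim (π-apart₂ (e⊕e∉L i≢j) (trans πx⊕eᵢ≡πy (sym πx⊕eⱼ≡πy)))
    where
    πx⊕eⱼ≡πy : π (x ⊕ e j) ≡ π y
    πx⊕eⱼ≡πy = trans (π-translate (e j) πx≡πy⊕eⱼ) (cong π (xy⊕y≡x y (e j)))

  no-multi : ∀ ed ed′ → Joins G ed′ (src G ed) (tgt G ed) → ed ≡ ed′
  no-multi ed ed′ ed′-joins with σ-surj ed | σ-surj ed′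
  ... | x , i , refl | y , j , refl =
    edge-determined (samePair-trans (samePair-sym (σ-ends x i)) (samePair-trans (samePair-sym ed′-joins) (σ-ends y j)))

  coloured-pair↔Fin2 : ∀ {i j} → i ≢ j → ∀ v →
    Σ (E G) (λ ed → (col G ed ≡ i ⊎ col G ed ≡ j) × Incident G ed v) ↔ Fin 2
  coloured-pair↔Fin2 {i} {j} i≢j v = mk↔ₛ′ to from to∘from from∘to
    where
    Edges = Σ (E G) (λ ed → (col G ed ≡ i ⊎ col G ed ≡ j) × Incident G ed v)
    to : Edges → Fin 2
    to (_ , inj₁ _ , _) = zero
    to (_ , inj₂ _ , _) = suc zero
    from : Fin 2 → Edges
    from zero       = σ (rep v) i , inj₁ (σ-col (rep v) i) , σ-incident v i
    from (suc zero) = σ (rep v) j , inj₂ (σ-col (rep v) j) , σ-incident v j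
    to∘from : ∀ k → to (from k) ≡ k
    to∘from zero       = refl
    to∘from (suc zero) = refl
    colour-irrelevant : ∀ {c} (p q : c ≡ i ⊎ c ≡ j) → p ≡ q
    colour-irrelevant (inj₁ p) (inj₁ q) = cong inj₁ (Decidable⇒UIP.≡-irrelevant _≟_ p q)
    colour-irrelevant (inj₁ p) (inj₂ q) = ⊥-elim (i≢j (trans (sym p) q))
    colour-irrelevant (inj₂ p) (inj₁ q) = ⊥-elim (i≢j (trans (sym q) p))
    colour-irrelevant (inj₂ p) (inj₂ q) = cong inj₂ (Decidable⇒UIP.≡-irrelevant _≟_ p q)
    irrelevant : ∀ ed (p q : (col G ed ≡ i ⊎ col G ed ≡ j) × Incident G ed v) → p ≡ q
    irrelevant ed (c , inc) (c′ , inc′) = cong₂ _,_ (colour-irrelevant c c′) (incident-irrelevant G (no-loops ed) inc inc′)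
    from∘to : ∀ p → from (to p) ≡ p
    from∘to (ed , inj₁ cᵢ , inc) = Σ-≡-irrelevant irrelevant (sym (trans (incident⇒σ inc) (cong (σ (rep v)) cᵢ)))
    from∘to (ed , inj₂ cⱼ , inc) = Σ-≡-irrelevant irrelevant (sym (trans (incident⇒σ inc) (cong (σ (rep v)) cⱼ)))

  squares : ∀ i j → i ≢ j → UnionOf4Cycles G (λ ed → col G ed ≡ i ⊎ col G ed ≡ j)
  squares i j i≢j v _ =
    coloured-pair↔Fin2 i≢j v , v₁ , v₂ , v₃ , σ x i , σ (x ⊕ e i) j , σ (x ⊕ e j) i , σ x j ,
    (inj₁ (σ-col x i) , inj₂ (σ-col (x ⊕ e i) j) , inj₁ (σ-col (x ⊕ e j) i) , inj₂ (σ-col x j)) ,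
    (joins₁ , σ-ends (x ⊕ e i) j , joins₃ , joins₄) ,
    (π-apart (e∉L i) ∘ trans (π-rep v) , v≢v₂ , π-apart (e∉L j) ∘ trans (π-rep v) ,
     π-apart (e∉L j) , π-apart₂ (e⊕e∉L i≢j) , v₂≢v₃)
    where
    x  = rep v
    v₁ = π (x ⊕ e i)
    v₂ = π ((x ⊕ e i) ⊕ e j)
    v₃ = π (x ⊕ e j)
    v₂≡π[x⊕eⱼ⊕eᵢ] : v₂ ≡ π ((x ⊕ e j) ⊕ e i)
    v₂≡π[x⊕eⱼ⊕eᵢ] = cong π (xy⊕z≡xz⊕y x (e i) (e j))
    joins₁ : Joins G (σ x i) v v₁
    joins₁ = subst (λ u → Joins G (σ x i) u v₁) (π-rep v) (σ-ends x i)
    joins₃ : Joins G (σ (x ⊕ e j) i) v₂ v₃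
    joins₃ = joins-sym G (subst (Joins G (σ (x ⊕ e j) i) v₃) (sym v₂≡π[x⊕eⱼ⊕eᵢ]) (σ-ends (x ⊕ e j) i))
    joins₄ : Joins G (σ x j) v₃ v
    joins₄ = joins-sym G (subst (λ u → Joins G (σ x j) u v₃) (π-rep v) (σ-ends x j))
    v≢v₂ : v ≢ v₂
    v≢v₂ eq = π-apart (e⊕e∉L i≢j) (trans (π-rep v) (trans eq (cong π (⊕-assoc x (e i) (e j)))))
    v₂≢v₃ : v₂ ≢ v₃
    v₂≢v₃ eq = π-apart (e∉L i) (sym (trans (sym v₂≡π[x⊕eⱼ⊕eᵢ]) eq))

  chromotopology : Chromotopology G
  chromotopology = record
    { finiteV     = finite-V
    ; finiteE     = finite-E
    ; nonempty    = π 𝟘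
    ; connected   = connected
    ; noLoops     = no-loops
    ; noMulti     = no-multi
    ; bipartite   = side , bipartite
    ; regular     = regular
    ; colorExists = λ v i → σ (rep v) i , σ-col (rep v) i , σ-incident v i
    ; colorUnique = colour-unique
    ; squares     = squares
    }

-- Actions by commuting involutions

module _ {A : Set} where

  act : ∀ {m} → (Fin m → A → A) → Word m → A → A
  act t []          a = a
  act t (false ∷ w) a = act (t ∘ suc) w a
  act t (true ∷ w)  a = t zero (act (t ∘ suc) w a)

  act-𝟘 : ∀ {m} (t : Fin m → A → A) a → act t 𝟘 a ≡ a
  act-𝟘 {zero}  t a = refl
  act-𝟘 {suc m} t a = act-𝟘 (t ∘ suc) a

  act-e : ∀ {m} (t : Fin m → A → A) i a → act t (e i) a ≡ t i a
  act-e t zero    a = cong (t zero) (act-𝟘 (t ∘ suc) a)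
  act-e t (suc i) a = act-e (t ∘ suc) i a

  act-natural : ∀ {m} (t : Fin m → A → A) (g : A → A) → (∀ i a → g (t i a) ≡ t i (g a)) →
                ∀ w a → g (act t w a) ≡ act t w (g a)
  act-natural t g g-comm []          a = refl
  act-natural t g g-comm (false ∷ w) a = act-natural (t ∘ suc) g (g-comm ∘ suc) w a
  act-natural t g g-comm (true ∷ w)  a =
    trans (g-comm zero _) (cong (t zero) (act-natural (t ∘ suc) g (g-comm ∘ suc) w a))

  Involutions : ∀ {m} → (Fin m → A → A) → Set
  Involutions t = ∀ i a → t i (t i a) ≡ a

  Commuting : ∀ {m} → (Fin m → A → A) → Set
  Commuting t = ∀ i j a → t i (t j a) ≡ t j (t i a)

  commuting-suc : ∀ {m} (t : Fin (suc m) → A → A) → Commuting t → Commuting (t ∘ suc)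
  commuting-suc t comm i j = comm (suc i) (suc j)

  act-⊕ : ∀ {m} (t : Fin m → A → A) → Involutions t → Commuting t →
          ∀ x y a → act t (x ⊕ y) a ≡ act t x (act t y a)
  act-⊕ t inv comm []          []          a = refl
  act-⊕ t inv comm (false ∷ x) (false ∷ y) a = act-⊕ (t ∘ suc) (inv ∘ suc) (commuting-suc t comm) x y a
  act-⊕ t inv comm (false ∷ x) (true ∷ y)  a = begin
    t zero (act t′ (x ⊕ y) a)                ≡⟨ cong (t zero) (act-⊕ t′ (inv ∘ suc) (commuting-suc t comm) x y a) ⟩
    t zero (act t′ x (act t′ y a))           ≡⟨ act-natural t′ (t zero) (comm zero ∘ suc) x _ ⟩
    act t′ x (t zero (act t′ y a))           ∎
    where
    open ≡-Reasoning
    t′ = t ∘ suc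
  act-⊕ t inv comm (true ∷ x)  (false ∷ y) a = cong (t zero) (act-⊕ (t ∘ suc) (inv ∘ suc) (commuting-suc t comm) x y a)
  act-⊕ t inv comm (true ∷ x)  (true ∷ y)  a = begin
    act t′ (x ⊕ y) a                         ≡⟨ act-⊕ t′ (inv ∘ suc) (commuting-suc t comm) x y a ⟩
    act t′ x (act t′ y a)                    ≡⟨ inv zero _ ⟨
    t zero (t zero (act t′ x (act t′ y a)))  ≡⟨ cong (t zero) (act-natural t′ (t zero) (comm zero ∘ suc) x _) ⟩
    t zero (act t′ x (t zero (act t′ y a)))  ∎
    where
    open ≡-Reasoning
    t′ = t ∘ suc

  act-involutive : ∀ {m} (t : Fin m → A → A) → Involutions t → Commuting t → ∀ x a → act t x (act t x a) ≡ a
  act-involutive t inv comm x a = begin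
    act t x (act t x a)  ≡⟨ act-⊕ t inv comm x x a ⟨
    act t (x ⊕ x) a      ≡⟨ cong (λ w → act t w a) (⊕-self x) ⟩
    act t 𝟘 a            ≡⟨ act-𝟘 t a ⟩
    a                    ∎
    where open ≡-Reasoning

  act-parity : ∀ {m} (t : Fin m → A → A) (side : A → Bool) → (∀ i a → side (t i a) ≡ not (side a)) →
               ∀ w a → side (act t w a) ≡ parity w xor side a
  act-parity t side flips []          a = refl
  act-parity t side flips (false ∷ w) a = act-parity (t ∘ suc) side (flips ∘ suc) w a
  act-parity t side flips (true ∷ w)  a = begin
    side (t zero (act (t ∘ suc) w a))   ≡⟨ flips zero _ ⟩
    not (side (act (t ∘ suc) w a))      ≡⟨ cong not (act-parity (t ∘ suc) side (flips ∘ suc) w a) ⟩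
    not (parity w xor side a)           ≡⟨ not-distribˡ-xor (parity w) (side a) ⟩
    not (parity w) xor side a           ∎
    where open ≡-Reasoning

-- Chromotopologies are quotients of the cube

module ChromotopologyIsQuotient {n} {G : ECGraph n} (C : Chromotopology G) where

  open Chromotopology C

  edgeAt : Fin n → V G → E G
  edgeAt i v = proj₁ (colorExists v i)

  col-edgeAt : ∀ i v → col G (edgeAt i v) ≡ i
  col-edgeAt i v = proj₁ (proj₂ (colorExists v i))

  edgeAt-incident : ∀ i v → Incident G (edgeAt i v) v
  edgeAt-incident i v = proj₂ (proj₂ (colorExists v i))

  edgeAt-unique : ∀ {ed i v} → col G ed ≡ i → Incident G ed v → ed ≡ edgeAt i v
  edgeAt-unique {ed} {i} {v} cᵢ inc = colorUnique v i ed (edgeAt i v) cᵢ inc (col-edgeAt i v) (edgeAt-incident i v)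

  opposite : ∀ ed {v} → Incident G ed v → V G
  opposite ed (inj₁ _) = tgt G ed
  opposite ed (inj₂ _) = src G ed

  joins-opposite : ∀ ed {v} (inc : Incident G ed v) → Joins G ed v (opposite ed inc)
  joins-opposite ed (inj₁ src≡v) = inj₁ (src≡v , refl)
  joins-opposite ed (inj₂ tgt≡v) = inj₂ (refl , tgt≡v)

  neighbour : Fin n → V G → V G
  neighbour i v = opposite (edgeAt i v) (edgeAt-incident i v)

  joins-neighbour : ∀ i v → Joins G (edgeAt i v) v (neighbour i v)
  joins-neighbour i v = joins-opposite (edgeAt i v) (edgeAt-incident i v)

  joins-functional : ∀ {ed u w w′} → Joins G ed u w → Joins G ed u w′ → w ≡ w′
  joins-functional {ed} {u} ed-joins ed-joins′ with samePair-trans (samePair-sym ed-joins) ed-joins′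
  ... | inj₁ (_ , w≡w′)     = w≡w′
  ... | inj₂ (u≡w′ , w≡u)   = ⊥-elim (noLoops ed (loop (subst (Joins G ed u) w≡u ed-joins)))
    where
    loop : Joins G ed u u → src G ed ≡ tgt G ed
    loop (inj₁ (p , q)) = trans p (sym q)
    loop (inj₂ (p , q)) = trans p (sym q)

  joins⇒neighbour : ∀ {ed u w} → Joins G ed u w → w ≡ neighbour (col G ed) u
  joins⇒neighbour {ed} {u} ed-joins =
    joins-functional (subst (λ d → Joins G d u _) (edgeAt-unique refl (joins⇒incident G ed-joins)) ed-joins)
                     (joins-neighbour (col G ed) u)

  neighbour-involutive : Involutions neighbour
  neighbour-involutive i u =
    sym (trans (joins⇒neighbour (joins-sym G (joins-neighbour i u))) (cong (λ c → neighbour c (neighbour i u)) (col-edgeAt i u)))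

  neighbour-back : ∀ {i u w} → w ≡ neighbour i u → neighbour i w ≡ u
  neighbour-back {i} {u} refl = neighbour-involutive i u

  edgeAt-neighbour : ∀ i u → edgeAt i (neighbour i u) ≡ edgeAt i u
  edgeAt-neighbour i u = sym (edgeAt-unique (col-edgeAt i u) (joins⇒incident G (joins-sym G (joins-neighbour i u))))

  SquareAt : Fin n → Fin n → V G → Set
  SquareAt a b v = (neighbour a (neighbour b v) ≡ neighbour b (neighbour a v)) × (neighbour a (neighbour b v) ≢ v)

  squareAt-sym : ∀ {a b v} → SquareAt a b v → SquareAt b a v
  squareAt-sym (ab≡ba , ab≢v) = sym ab≡ba , (λ ba≡v → ab≢v (trans ab≡ba ba≡v))

  alternating-cycle⇒square : ∀ {a b v v₁ v₂ v₃} → v₁ ≡ neighbour a v → v₂ ≡ neighbour b v₁ →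
                             v₃ ≡ neighbour a v₂ → v ≡ neighbour b v₃ → v ≢ v₂ → SquareAt a b v
  alternating-cycle⇒square {a} {b} {v} {v₁} {v₂} {v₃} p₁ p₂ p₃ p₄ v≢v₂ = ab≡ba , (λ ab≡v → v≢v₂ (trans (sym ab≡v) ab≡v₂))
    where
    open ≡-Reasoning
    ab≡v₂ : neighbour a (neighbour b v) ≡ v₂
    ab≡v₂ = trans (cong (neighbour a) (neighbour-back p₄)) (neighbour-back p₃)
    ab≡ba : neighbour a (neighbour b v) ≡ neighbour b (neighbour a v)
    ab≡ba = begin
      neighbour a (neighbour b v)  ≡⟨ ab≡v₂ ⟩
      v₂                           ≡⟨ p₂ ⟩
      neighbour b v₁               ≡⟨ cong (neighbour b) p₁ ⟩
      neighbour b (neighbour a v)  ∎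

  no-backtracking : ∀ {a b v v₁ v₂} → v₁ ≡ neighbour a v → v₂ ≡ neighbour b v₁ → v ≢ v₂ → a ≢ b
  no-backtracking p₁ p₂ v≢v₂ refl = v≢v₂ (sym (trans p₂ (neighbour-back p₁)))

  two-colours : ∀ {i j a b c : Fin n} → a ≡ i ⊎ a ≡ j → b ≡ i ⊎ b ≡ j → c ≡ i ⊎ c ≡ j → a ≢ b → b ≢ c → a ≡ c
  two-colours (inj₁ refl) (inj₁ refl) _           a≢b _   = ⊥-elim (a≢b refl)
  two-colours (inj₁ refl) (inj₂ refl) (inj₁ refl) _   _   = refl
  two-colours (inj₁ refl) (inj₂ refl) (inj₂ refl) _   b≢c = ⊥-elim (b≢c refl)
  two-colours (inj₂ refl) (inj₁ refl) (inj₁ refl) _   b≢c = ⊥-elim (b≢c refl)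
  two-colours (inj₂ refl) (inj₁ refl) (inj₂ refl) _   _   = refl
  two-colours (inj₂ refl) (inj₂ refl) _           a≢b _   = ⊥-elim (a≢b refl)

  orient : ∀ {i j a b v} → a ≡ i ⊎ a ≡ j → b ≡ i ⊎ b ≡ j → a ≢ b → SquareAt a b v → SquareAt i j v
  orient (inj₁ refl) (inj₁ refl) a≢b _   = ⊥-elim (a≢b refl)
  orient (inj₁ refl) (inj₂ refl) _   sq  = sq
  orient (inj₂ refl) (inj₁ refl) _   sq  = squareAt-sym sq
  orient (inj₂ refl) (inj₂ refl) a≢b _   = ⊥-elim (a≢b refl)

  squareAt : ∀ {i j} → i ≢ j → ∀ v → SquareAt i j v
  squareAt {i} {j} i≢j v with squares i j i≢j v (edgeAt i v , inj₁ (col-edgeAt i v) , edgeAt-incident i v)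
  ... | _ , v₁ , v₂ , v₃ , e₁ , e₂ , e₃ , e₄ , (ij₁ , ij₂ , ij₃ , ij₄) , (J₁ , J₂ , J₃ , J₄) , (_ , v≢v₂ , _ , _ , v₁≢v₃ , _) =
    orient ij₁ ij₂ c₁≢c₂ (alternating-cycle⇒square p₁ p₂ (subst (λ c → v₃ ≡ neighbour c v₂) (sym c₁≡c₃) p₃)
                                                  (subst (λ c → v ≡ neighbour c v₃) (sym c₂≡c₄) p₄) v≢v₂)
    where
    p₁ = joins⇒neighbour J₁
    p₂ = joins⇒neighbour J₂
    p₃ = joins⇒neighbour J₃
    p₄ = joins⇒neighbour J₄
    c₁≢c₂ = no-backtracking p₁ p₂ v≢v₂
    c₂≢c₃ = no-backtracking p₂ p₃ v₁≢v₃
    c₃≢c₄ = no-backtracking p₃ p₄ (v≢v₂ ∘ sym)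
    c₁≡c₃ = two-colours ij₁ ij₂ ij₃ c₁≢c₂ c₂≢c₃
    c₂≡c₄ = two-colours ij₂ ij₃ ij₄ c₂≢c₃ c₃≢c₄

  neighbour-commute : Commuting neighbour
  neighbour-commute i j v with i ≟ j
  ... | yes refl = refl
  ... | no i≢j   = proj₁ (squareAt i≢j v)

  infixr 5 _·_
  _·_ : Word n → V G → V G
  x · u = act neighbour x u

  ·-⊕ : ∀ x y u → (x ⊕ y) · u ≡ x · y · u
  ·-⊕ = act-⊕ neighbour neighbour-involutive neighbour-commute

  ·-involutive : ∀ x u → x · x · u ≡ u
  ·-involutive = act-involutive neighbour neighbour-involutive neighbour-commute

  v₀ : V G
  v₀ = nonempty

  π : Word n → V G
  π x = x · v₀

  π-⊕e : ∀ x i → π (x ⊕ e i) ≡ neighbour i (π x)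
  π-⊕e x i = begin
    π (x ⊕ e i)        ≡⟨ cong π (⊕-comm x (e i)) ⟩
    (e i ⊕ x) · v₀     ≡⟨ ·-⊕ (e i) x v₀ ⟩
    e i · π x          ≡⟨ act-e neighbour i (π x) ⟩
    neighbour i (π x)  ∎
    where open ≡-Reasoning

  _≟V_ : DecidableEquality (V G)
  _≟V_ = inj⇒≟ (↔⇒↣ (proj₂ finiteV))

  fixes : Word n → Bool
  fixes w = isYes (π w ≟V v₀)

  fixes⇒≡ : ∀ w → fixes w ≡ true → π w ≡ v₀
  fixes⇒≡ w = toWitness ∘ Equivalence.from T-≡

  ≡⇒fixes : ∀ w → π w ≡ v₀ → fixes w ≡ true
  ≡⇒fixes w = Equivalence.to T-≡ ∘ fromWitness

  stabiliser : Code n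
  stabiliser = record
    { mem   = fixes
    ; mem-𝟘 = ≡⇒fixes 𝟘 (act-𝟘 neighbour v₀)
    ; mem-⊕ = λ x y x∈ y∈ → ≡⇒fixes (x ⊕ y) (begin
        (x ⊕ y) · v₀  ≡⟨ ·-⊕ x y v₀ ⟩
        x · π y       ≡⟨ cong (x ·_) (fixes⇒≡ y y∈) ⟩
        π x           ≡⟨ fixes⇒≡ x x∈ ⟩
        v₀            ∎)
    }
    where open ≡-Reasoning

  π-kernel : ∀ x y → (π x ≡ π y) ⇔ (fixes (x ⊕ y) ≡ true)
  π-kernel x y = mk⇔ (λ πx≡πy → ≡⇒fixes (x ⊕ y) (begin
      (x ⊕ y) · v₀  ≡⟨ ·-⊕ x y v₀ ⟩
      x · π y       ≡⟨ cong (x ·_) πx≡πy ⟨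
      x · x · v₀    ≡⟨ ·-involutive x v₀ ⟩
      v₀            ∎))
    (λ x⊕y∈ → sym (begin
      π y           ≡⟨ ·-involutive x (π y) ⟨
      x · x · π y   ≡⟨ cong (x ·_) (·-⊕ x y v₀) ⟨
      x · π (x ⊕ y) ≡⟨ cong (x ·_) (fixes⇒≡ (x ⊕ y) x⊕y∈) ⟩
      π x           ∎))
    where open ≡-Reasoning

  side : V G → Bool
  side = proj₁ bipartite

  side-neighbour : ∀ i u → side (neighbour i u) ≡ not (side u)
  side-neighbour i u = ¬-not (≢-sym (samePair-apart side (joins-neighbour i u) (proj₂ bipartite (edgeAt i u))))

  stabiliser-even : Even stabiliser
  stabiliser-even w w∈ = parity≡false⇒2∣weight w (x-xor-y≡y⇒x≡false (parity w) (side v₀) (begin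
    parity w xor side v₀   ≡⟨ act-parity neighbour side side-neighbour w v₀ ⟨
    side (π w)             ≡⟨ cong side (fixes⇒≡ w w∈) ⟩
    side v₀                ∎))
    where
    open ≡-Reasoning
    x-xor-y≡y⇒x≡false : ∀ x y → x xor y ≡ y → x ≡ false
    x-xor-y≡y⇒x≡false false _     _  = refl
    x-xor-y≡y⇒x≡false true  false ()
    x-xor-y≡y⇒x≡false true  true  ()

  stabiliser-noWeight2 : NoWeight2 stabiliser
  stabiliser-noWeight2 w w∈ weight≡2 with weight≡2⇒e⊕e w weight≡2
  ... | i , j , i≢j , refl = proj₂ (squareAt i≢j v₀) (begin
    neighbour i (neighbour j v₀)  ≡⟨ act-e neighbour i _ ⟨
    e i · neighbour j v₀          ≡⟨ cong (e i ·_) (act-e neighbour j v₀) ⟨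
    e i · e j · v₀                ≡⟨ ·-⊕ (e i) (e j) v₀ ⟨
    π (e i ⊕ e j)                 ≡⟨ fixes⇒≡ (e i ⊕ e j) w∈ ⟩
    v₀                            ∎)
    where open ≡-Reasoning

  reach : ∀ {u w} → Walk G u w → ∃[ x ] π x ≡ u → ∃[ y ] π y ≡ w
  reach here                   πx≡u      = πx≡u
  reach (step ed ed-joins walk) (x , πx≡u) =
    reach walk (x ⊕ e (col G ed) , trans (π-⊕e x (col G ed)) (trans (cong (neighbour (col G ed)) πx≡u) (sym (joins⇒neighbour ed-joins))))

  π-surjective : ∀ v → ∃[ x ] π x ≡ v
  π-surjective v = reach (connected v₀ v) (𝟘 , act-𝟘 neighbour v₀)

  σ : Word n → Fin n → E G
  σ x i = edgeAt i (π x)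

  σ-kernel : ∀ x y i j → (σ x i ≡ σ y j) ⇔ (i ≡ j × (fixes (x ⊕ y) ≡ true ⊎ fixes ((x ⊕ y) ⊕ e i) ≡ true))
  σ-kernel x y i j = mk⇔ same-edge⇒ ⇒same-edge
    where
    same-edge⇒ : σ x i ≡ σ y j → i ≡ j × (fixes (x ⊕ y) ≡ true ⊎ fixes ((x ⊕ y) ⊕ e i) ≡ true)
    same-edge⇒ eq = i≡j , Sum.map πy≡πx⇒ πy≡πx⊕eᵢ⇒ πy-endpoint
      where
      i≡j : i ≡ j
      i≡j = trans (sym (col-edgeAt i (π x))) (trans (cong (col G) eq) (col-edgeAt j (π y)))
      πy-endpoint : π y ≡ π x ⊎ π y ≡ neighbour i (π x)
      πy-endpoint = incident⇒endpoint G (joins-neighbour i (π x))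
                      (subst (λ d → Incident G d (π y)) (sym eq) (edgeAt-incident j (π y)))
      πy≡πx⇒ : π y ≡ π x → fixes (x ⊕ y) ≡ true
      πy≡πx⇒ πy≡πx = Equivalence.to (π-kernel x y) (sym πy≡πx)
      πy≡πx⊕eᵢ⇒ : π y ≡ neighbour i (π x) → fixes ((x ⊕ y) ⊕ e i) ≡ true
      πy≡πx⊕eᵢ⇒ πy≡πx⊕eᵢ = ∈-resp stabiliser (xy⊕z≡xz⊕y x (e i) y)
                              (Equivalence.to (π-kernel (x ⊕ e i) y) (trans (π-⊕e x i) (sym πy≡πx⊕eᵢ)))
    ⇒same-edge : i ≡ j × (fixes (x ⊕ y) ≡ true ⊎ fixes ((x ⊕ y) ⊕ e i) ≡ true) → σ x i ≡ σ y j
    ⇒same-edge (refl , inj₁ x⊕y∈) = cong (edgeAt i) (Equivalence.from (π-kernel x y) x⊕y∈)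
    ⇒same-edge (refl , inj₂ x⊕y⊕eᵢ∈) = begin
      edgeAt i (π x)                 ≡⟨ cong (edgeAt i) (Equivalence.from (π-kernel x (y ⊕ e i)) (∈-resp stabiliser (⊕-assoc x y (e i)) x⊕y⊕eᵢ∈)) ⟩
      edgeAt i (π (y ⊕ e i))         ≡⟨ cong (edgeAt i) (π-⊕e y i) ⟩
      edgeAt i (neighbour i (π y))   ≡⟨ edgeAt-neighbour i (π y) ⟩
      edgeAt i (π y)                 ∎
      where open ≡-Reasoning

  isoToQuotient : IsoToQuotient G stabiliser
  isoToQuotient = record
    { π      = π
    ; σ      = σ
    ; π-surj = π-surjective
    ; π-ker  = π-kernel
    ; σ-surj = λ ed → let (x , πx≡src) = π-surjective (src G ed) in
                 x , col G ed , sym (edgeAt-unique refl (inj₁ (sym πx≡src)))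
    ; σ-ker  = σ-kernel
    ; σ-col  = λ x i → col-edgeAt i (π x)
    ; σ-ends = λ x i → subst (Joins G (σ x i) (π x)) (sym (π-⊕e x i)) (joins-neighbour i (π x))
    }

mainTheorem3 : (n : ℕ) (G : ECGraph n) →
    Chromotopology G ⇔ Σ (Code n) (λ L → Even L × NoWeight2 L × IsoToQuotient G L)
mainTheorem3 n G = mk⇔
  (λ C → let open ChromotopologyIsQuotient C in stabiliser , stabiliser-even , stabiliser-noWeight2 , isoToQuotient)
  (λ (L , even , noWeight2 , Q) → QuotientIsChromotopology.chromotopology even noWeight2 Q)
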